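{- For $r\ge 2$ and $n\ge r$, \[W_n^{(r)}(x,y)=x\sum_{i=1}^{r-1}(n-1)_{i-1}\,W_{n-i}^{(r)}(x,y)+(y+n-r)(n-1)_{r-1}\,W_{n-r}^{(r)}(x,y),\] where $W_n^{(r)}(x,y)=x^{(n)}$ for $0\le n\le r-1$.
   Context: Fix an integer $r\ge 2$. A cycle of a permutation is $r$-regular if its length is not divisible by $r$, and $r$-singular if its length is divisible by $r$. For $\sigma\in S_n$ (permutations of $\{1,\dots,n\}$), let $r(\sigma)$ and $s(\sigma)$ be the numbers of $r$-regular and $r$-singular cycles of $\sigma$. Define $W_0^{(r)}(x,y)=1$ and $W_n^{(r)}(x,y)=\sum_{\sigma\in S_n}x^{r(\sigma)}y^{s(\sigma)}$ for $n\ge1$. Notation: $(m)_0=1$, $(m)_k=m(m-1)\cdots(m-k+1)$; $x^{(0)}=1$, $x^{(n)}=x(x+1)\cdots(x+n-1)$. -}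

module Defs where

open import Level using (Level)
open import Data.Nat using (ℕ; zero; suc; _∸_; _<ᵇ_) renaming (_+_ to _+ℕ_; _*_ to _*ℕ_)
open import Data.Nat.Divisibility using (_∣?_)
open import Data.Fin using (Fin; toℕ)
open import Data.Fin.Properties using () renaming (_≟_ to _≟ᶠ_)
open import Data.Vec using (Vec; []; _∷_; lookup)
open import Data.List using (List; []; _∷_; map; concatMap; filterᵇ; upTo; allFin; foldr)
open import Data.Bool.ListAction using (all)
open import Data.Bool using (Bool; true; false; _∧_; not; if_then_else_)
open import Relation.Nullary.Decidable using (⌊_⌋)
open import Algebra.Bundles using (CommutativeSemiring)

-- Permutations of {0,…,n-1}, enumerated explicitly.
-- A permutation is represented by the vector (σ 0, …, σ (n-1)); S_n is
-- the list of all injective such vectors (each appears exactly once).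

vecsOver : {A : Set} → List A → (m : ℕ) → List (Vec A m)
vecsOver xs zero    = [] ∷ []
vecsOver xs (suc m) = concatMap (λ v → map (λ a → a ∷ v) xs) (vecsOver xs m)

_⇒ᵇ_ : Bool → Bool → Bool
a ⇒ᵇ b = not a Data.Bool.∨ b

isInjective : {n : ℕ} → Vec (Fin n) n → Bool
isInjective {n} v =
  all (λ i → all (λ j → ⌊ lookup v i ≟ᶠ lookup v j ⌋ ⇒ᵇ ⌊ i ≟ᶠ j ⌋) (allFin n)) (allFin n)

Perms : (n : ℕ) → List (Vec (Fin n) n)
Perms n = filterᵇ isInjective (vecsOver (allFin n) n)

iter : {n : ℕ} → Vec (Fin n) n → ℕ → Fin n → Fin n
iter σ zero    i = i
iter σ (suc k) i = lookup σ (iter σ k i)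

firstSat : (ℕ → Bool) → List ℕ → ℕ
firstSat p []       = 0
firstSat p (k ∷ ks) = if p k then k else firstSat p ks

cycleLen : {n : ℕ} → Vec (Fin n) n → Fin n → ℕ
cycleLen {n} σ i = firstSat (λ k → ⌊ iter σ k i ≟ᶠ i ⌋) (map suc (upTo n))

isLeader : {n : ℕ} → Vec (Fin n) n → Fin n → Bool
isLeader σ i = all (λ k → toℕ i <ᵇ toℕ (iter σ k i)) (map suc (upTo (cycleLen σ i ∸ 1)))

countCycles : {n : ℕ} → (ℕ → Bool) → Vec (Fin n) n → ℕ
countCycles {n} p σ =
  foldr _+ℕ_ 0 (map (λ i → if isLeader σ i ∧ p (cycleLen σ i) then 1 else 0) (allFin n))

regCycles : (r : ℕ) → {n : ℕ} → Vec (Fin n) n → ℕ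
regCycles r = countCycles (λ len → not ⌊ r ∣? len ⌋)

singCycles : (r : ℕ) → {n : ℕ} → Vec (Fin n) n → ℕ
singCycles r = countCycles (λ len → ⌊ r ∣? len ⌋)

falling : ℕ → ℕ → ℕ
falling m zero    = 1
falling m (suc k) = (m ∸ k) *ℕ falling m k

module _ {c ℓ : Level} (R : CommutativeSemiring c ℓ) where
  open CommutativeSemiring R

  pow : Carrier → ℕ → Carrier
  pow x zero    = 1#
  pow x (suc k) = x * pow x k

  fromℕ : ℕ → Carrier
  fromℕ zero    = 0#
  fromℕ (suc k) = 1# + fromℕ k

  sumR : List Carrier → Carrier
  sumR = foldr _+_ 0#

  rising : Carrier → ℕ → Carrier
  rising x zero    = 1#
  rising x (suc k) = rising x k * (x + fromℕ k)

  W : (r n : ℕ) → Carrier → Carrier → Carrier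
  W r n x y = sumR (map (λ σ → pow x (regCycles r σ) * pow y (singCycles r σ)) (Perms n))

{-# OPTIONS --safe #-}
module Submission where

-- Weight a permutation by x per r-regular and y per r-singular cycle, so that W n is the total
-- weight of S_n, and write w L for the weight of a cycle of length L.  Each σ ∈ S_{m+1} arises
-- exactly once from a = σ 0 and some τ ∈ S_m: for a = 0 by adding 0 as a fixed point, otherwise by
-- inserting a new point a right after 0 in the cycle of 0, which lengthens that cycle by one and
-- keeps every other cycle together with its least element.  So the sums U_m g over S_{m+1} in which
-- the cycle through 0 is weighted by g instead of w satisfy
--   U_0 g = g 1 · W_0,   U_{m+1} g = g 1 · W_{m+1} + (m + 1) · U_m (g ∘ suc),   W_{m+1} = U_m w.
-- For n = r + d, unfolding r - 1 steps of W_n = U_{n-1} w yields the terms in which the cycle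
-- through 0 is shorter than r, each weighted x, plus (n - 1)_{r-1} · U_d (w ∘ (r - 1 +_)); as w is
-- r-periodic with w r = y, that last U_d is (y + d) · W_d.  For n < r every cycle is regular and
-- one step gives W_{m+1} = (x + m) · W_m.

open import Defs
open import Level using (Level)
open import Algebra.Bundles using (CommutativeSemiring)
import Algebra.Properties.CommutativeSemigroup as CommutativeSemigroup
open import Data.Bool using (Bool; true; false; _∧_; not; T; if_then_else_)
open import Data.Bool.ListAction using (all; and)
open import Data.Bool.Properties using (∧-zeroʳ; T-≡)
open import Data.Fin using (Fin; zero; suc; toℕ; punchIn; punchOut)
open import Data.Fin.Permutation as Perm using (Permutation′; _⟨$⟩ʳ_; _⟨$⟩ˡ_)
import Data.Fin.Properties as Fin
open import Data.Fin.Properties using (_≟_)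
open import Data.List as List
  using (List; []; _∷_; map; upTo; applyUpTo; allFin; concatMap; cartesianProductWith; _++_)
import Data.List.Properties as List
open import Data.List.Membership.Propositional using (_∈_)
import Data.List.Membership.Propositional.Properties as ∈
open import Data.List.Membership.Propositional.Properties.WithK using (unique∧set⇒bag)
open import Data.List.Relation.Binary.BagAndSetEquality using (∼bag⇒↭)
open import Data.List.Relation.Binary.Permutation.Propositional using (_↭_)
import Data.List.Relation.Binary.Permutation.Propositional as ↭
import Data.List.Relation.Binary.Permutation.Propositional.Properties as ↭
import Data.List.Relation.Binary.Permutation.Setoid.Properties as ↭ₛ
import Data.List.Relation.Unary.All as All
import Data.List.Relation.Unary.All.Properties as All
import Data.List.Relation.Unary.AllPairs as AllPairs
open import Data.List.Relation.Unary.Any using (here; there)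
open import Data.List.Relation.Unary.Unique.Propositional using (Unique)
import Data.List.Relation.Unary.Unique.Propositional.Properties as Unique
open import Data.Maybe using (Maybe; just; nothing; maybe′)
open import Data.Nat using (ℕ; zero; suc; _∸_; _≤_; _<_; z≤n; s≤s; z<s; s<s; _<ᵇ_)
  renaming (_+_ to _+ℕ_; _*_ to _*ℕ_)
import Data.Nat.Properties as ℕ
open import Data.Nat.Divisibility using (_∣?_; ∣⇒≤; ∣-refl; ∣m∣n⇒∣m+n; ∣m+n∣m⇒∣n)
open import Data.Product using (_×_; _,_; proj₂; ∃-syntax)
open import Data.Vec using (Vec; []; _∷_; lookup; tabulate)
import Data.Vec.Properties as Vec
open import Function using (_∘_; id)
open import Function.Bundles using (Equivalence; _⇔_; mk⇔)
open import Function.Definitions using (Injective)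
open import Relation.Nullary using (¬_; Dec; yes; no; contradiction)
open import Relation.Nullary.Decidable using (⌊_⌋; isYes≗does; dec-true; toWitness; fromWitness; T?)
open import Relation.Binary.PropositionalEquality
  using (_≡_; _≢_; refl; sym; trans; cong; cong₂; subst; _≗_; module ≡-Reasoning)

module _ {A : Set} (p : A → Bool) where

  all-applyUpTo-true : ∀ (f : ℕ → A) n → (∀ {i} → i < n → p (f i) ≡ true) →
                       all p (applyUpTo f n) ≡ true
  all-applyUpTo-true f zero    _  = refl
  all-applyUpTo-true f (suc n) pf rewrite pf z<s = all-applyUpTo-true (f ∘ suc) n (pf ∘ s<s)

  all-applyUpTo-false : ∀ (f : ℕ → A) {i n} → i < n → p (f i) ≡ false →
                        all p (applyUpTo f n) ≡ false
  all-applyUpTo-false f z<s       pfi rewrite pfi = refl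
  all-applyUpTo-false f {suc i} (s<s i<n) pfi =
    trans (cong (p (f 0) ∧_) (all-applyUpTo-false (f ∘ suc) {i} i<n pfi)) (∧-zeroʳ _)

all-cong : ∀ {A : Set} {p q : A → Bool} → p ≗ q → ∀ xs → all p xs ≡ all q xs
all-cong p≗q xs = cong and (List.map-cong p≗q xs)

firstSat-applyUpTo : ∀ p (f : ℕ → ℕ) {j n} → j < n → p (f j) ≡ true →
  ∃[ k ] k ≤ j × firstSat p (applyUpTo f n) ≡ f k × p (f k) ≡ true ×
          (∀ {i} → i < k → p (f i) ≡ false)
firstSat-applyUpTo p f {j} {suc n} j<n pfj with p (f 0) in pf0 | j | j<n
... | true  | _      | _         = 0 , z≤n , refl , pf0 , λ ()
... | false | zero   | _         = contradiction (trans (sym pf0) pfj) λ ()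
... | false | suc j′ | s<s j′<n
  with k , k≤j′ , first , pfk , before ← firstSat-applyUpTo p (f ∘ suc) j′<n pfj
  = suc k , s≤s k≤j′ , first , pfk , λ { {zero} _ → pf0 ; {suc i} (s<s i<k) → before i<k }

all-below-true : ∀ (p : ℕ → Bool) L → (∀ {k} → 0 < k → k < L → p k ≡ true) →
                 all p (map suc (upTo (L ∸ 1))) ≡ true
all-below-true p zero    _  = refl
all-below-true p (suc L) pk = trans (cong (all p) (List.map-upTo suc L))
  (all-applyUpTo-true p suc L (λ k<L → pk z<s (s<s k<L)))

all-below-false : ∀ (p : ℕ → Bool) {k L} → 0 < k → k < L → p k ≡ false →
                  all p (map suc (upTo (L ∸ 1))) ≡ false
all-below-false p {suc k} {suc L} _ (s<s k<L) pk = trans (cong (all p) (List.map-upTo suc L))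
  (all-applyUpTo-false p suc k<L pk)

⌊⌋-true : ∀ {A : Set} (a? : Dec A) → A → ⌊ a? ⌋ ≡ true
⌊⌋-true a? a = trans (isYes≗does a?) (dec-true a? a)

⌊⌋-true⁻ : ∀ {A : Set} (a? : Dec A) → ⌊ a? ⌋ ≡ true → A
⌊⌋-true⁻ a? e = toWitness (Equivalence.from T-≡ e)

-- Cycle lengths and leaders

IsPerm : ∀ {n} → Vec (Fin n) n → Set
IsPerm σ = Injective _≡_ _≡_ (lookup σ)

record IsCycleLength {n} (σ : Vec (Fin n) n) (i : Fin n) (L : ℕ) : Set where
  field
    positive : 0 < L
    returns  : iter σ L i ≡ i
    minimal  : ∀ {k} → 0 < k → k < L → iter σ k i ≢ i

open IsCycleLength public

module _ {n : ℕ} (σ : Vec (Fin n) n) where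

  iter-+ : ∀ k l i → iter σ (k +ℕ l) i ≡ iter σ k (iter σ l i)
  iter-+ zero    l i = refl
  iter-+ (suc k) l i = cong (lookup σ) (iter-+ k l i)

  iter-comm : ∀ k l i → iter σ k (iter σ l i) ≡ iter σ l (iter σ k i)
  iter-comm k l i = begin
    iter σ k (iter σ l i) ≡⟨ iter-+ k l i ⟨
    iter σ (k +ℕ l) i      ≡⟨ cong (λ m → iter σ m i) (ℕ.+-comm k l) ⟩
    iter σ (l +ℕ k) i      ≡⟨ iter-+ l k i ⟩
    iter σ l (iter σ k i) ∎
    where open ≡-Reasoning

  iter-injective : IsPerm σ → ∀ k → Injective _≡_ _≡_ (iter σ k)
  iter-injective σ-perm zero    eq = eq
  iter-injective σ-perm (suc k) eq = iter-injective σ-perm k (σ-perm eq)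

  cycleLen-least : ∀ {i L} → 0 < L → L ≤ n → iter σ L i ≡ i →
                   ∃[ C ] C ≤ L × cycleLen σ i ≡ C × IsCycleLength σ i C
  cycleLen-least {i} {suc j} _ j<n ret
    with k , k≤j , first , hit , before ←
           firstSat-applyUpTo (λ k → ⌊ iter σ k i ≟ i ⌋) suc j<n (⌊⌋-true (_ ≟ i) ret)
    = suc k , s≤s k≤j , trans (cong (firstSat _) (List.map-upTo suc n)) first , record
      { positive = z<s
      ; returns = ⌊⌋-true⁻ (_ ≟ i) hit
      ; minimal = λ { {suc l} _ (s<s l<k) ret′ →
                      contradiction (trans (sym (⌊⌋-true (_ ≟ i) ret′)) (before l<k)) λ () }
      }

  IsCycleLength⇒cycleLen≡ : ∀ {i L} → IsCycleLength σ i L → L ≤ n → cycleLen σ i ≡ L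
  IsCycleLength⇒cycleLen≡ isL L≤n
    with C , C≤L , cyc≡C , isC ← cycleLen-least (positive isL) L≤n (returns isL)
    = trans cyc≡C (ℕ.≤∧≮⇒≡ C≤L λ C<L → minimal isL (positive isC) C<L (returns isC))

  returns-within : IsPerm σ → ∀ i → ∃[ L ] 0 < L × L ≤ n × iter σ L i ≡ i
  returns-within σ-perm i
    with a , b , a<b , same ← Fin.pigeonhole (ℕ.n<1+n n) (λ (k : Fin (suc n)) → iter σ (toℕ k) i)
    = toℕ b ∸ toℕ a , ℕ.m<n⇒0<n∸m a<b ,
      ℕ.≤-trans (ℕ.m∸n≤m (toℕ b) (toℕ a)) (Fin.toℕ≤pred[n] b) ,
      iter-injective σ-perm (toℕ a) (begin
        iter σ (toℕ a) (iter σ (toℕ b ∸ toℕ a) i) ≡⟨ iter-comm (toℕ a) (toℕ b ∸ toℕ a) i ⟩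
        iter σ (toℕ b ∸ toℕ a) (iter σ (toℕ a) i) ≡⟨ iter-+ (toℕ b ∸ toℕ a) (toℕ a) i ⟨
        iter σ (toℕ b ∸ toℕ a +ℕ toℕ a) i          ≡⟨ cong (λ m → iter σ m i) (ℕ.m∸n+n≡m (ℕ.<⇒≤ a<b)) ⟩
        iter σ (toℕ b) i                          ≡⟨ same ⟨
        iter σ (toℕ a) i                          ∎)
    where open ≡-Reasoning

  cycleLen-isCycleLength : IsPerm σ → ∀ i → IsCycleLength σ i (cycleLen σ i)
  cycleLen-isCycleLength σ-perm i
    with L , 0<L , L≤n , ret ← returns-within σ-perm i
    with C , _ , cyc≡C , isC ← cycleLen-least 0<L L≤n ret
    = subst (IsCycleLength σ i) (sym cyc≡C) isC

  cycleLen≤n : IsPerm σ → ∀ i → cycleLen σ i ≤ n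
  cycleLen≤n σ-perm i
    with L , 0<L , L≤n , ret ← returns-within σ-perm i
    with C , C≤L , cyc≡C , _ ← cycleLen-least 0<L L≤n ret
    = subst (_≤ n) (sym cyc≡C) (ℕ.≤-trans C≤L L≤n)

  cycleLen-iter : IsPerm σ → ∀ k i → cycleLen σ (iter σ k i) ≡ cycleLen σ i
  cycleLen-iter σ-perm k i = IsCycleLength⇒cycleLen≡ isL (cycleLen≤n σ-perm i)
    where
    L = cycleLen σ i
    isC = cycleLen-isCycleLength σ-perm i
    isL : IsCycleLength σ (iter σ k i) (cycleLen σ i)
    isL = record
      { positive = positive isC
      ; returns  = trans (iter-comm L k i) (cong (iter σ k) (returns isC))
      ; minimal  = λ {l} 0<l l<L ret →
          minimal isC 0<l l<L (iter-injective σ-perm k (trans (iter-comm k l i) ret))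
      }

  OnOrbit : Fin n → ℕ → Fin n → Set
  OnOrbit z L x = ∃[ i ] i < L × iter σ i z ≡ x

  OnOrbit-lookup⁻ : IsPerm σ → ∀ {z L x} → IsCycleLength σ z L →
                    OnOrbit z L (lookup σ x) → OnOrbit z L x
  OnOrbit-lookup⁻ σ-perm {L = zero}  isL _ = contradiction (positive isL) λ ()
  OnOrbit-lookup⁻ σ-perm {L = suc L} isL (suc i , s<s i<L , e) = i , ℕ.m<n⇒m<1+n i<L , σ-perm e
  OnOrbit-lookup⁻ σ-perm {L = suc L} isL (zero , _ , e) = L , ℕ.n<1+n L , σ-perm (trans (returns isL) e)

  ¬OnOrbit-iter : IsPerm σ → ∀ {z L x} → IsCycleLength σ z L →
                  ¬ OnOrbit z L x → ∀ j → ¬ OnOrbit z L (iter σ j x)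
  ¬OnOrbit-iter σ-perm isL x∉ zero    = x∉
  ¬OnOrbit-iter σ-perm isL x∉ (suc j) = ¬OnOrbit-iter σ-perm isL x∉ j ∘ OnOrbit-lookup⁻ σ-perm isL

cycleLedBy : ∀ {n} → Vec (Fin n) n → Fin n → Maybe ℕ
cycleLedBy σ i = if isLeader σ i then just (cycleLen σ i) else nothing

cycleLedBy-nonLeader : ∀ {n} (σ : Vec (Fin n) n) {i} → isLeader σ i ≡ false → cycleLedBy σ i ≡ nothing
cycleLedBy-nonLeader σ {i} e = cong (λ b → if b then just (cycleLen σ i) else nothing) e

module _ {m : ℕ} (σ : Vec (Fin (suc m)) (suc m)) where

  isLeader-zero : IsPerm σ → isLeader σ zero ≡ true
  isLeader-zero σ-perm = all-below-true _ (cycleLen σ zero) above-zero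
    where
    above-zero : ∀ {k} → 0 < k → k < cycleLen σ zero → (0 <ᵇ toℕ (iter σ k zero)) ≡ true
    above-zero {k} 0<k k<L with iter σ k zero in eq
    ... | zero  = contradiction eq (minimal (cycleLen-isCycleLength σ σ-perm zero) 0<k k<L)
    ... | suc _ = refl

  isLeader-false : ∀ {j k} → 0 < k → k < cycleLen σ j → iter σ k j ≡ zero → isLeader σ j ≡ false
  isLeader-false {j} 0<k k<L ret = all-below-false _ 0<k k<L (cong (λ z → toℕ j <ᵇ toℕ z) ret)

  isLeader-orbit-zero : IsPerm σ → ∀ {k} → 0 < k → k < cycleLen σ zero →
                        isLeader σ (iter σ k zero) ≡ false
  isLeader-orbit-zero σ-perm {k} 0<k k<L =
    isLeader-false {iter σ k zero} {L ∸ k} (ℕ.m<n⇒0<n∸m k<L) shorter back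
    where
    L = cycleLen σ zero
    shorter : L ∸ k < cycleLen σ (iter σ k zero)
    shorter = subst (L ∸ k <_) (sym (cycleLen-iter σ σ-perm k zero)) (ℕ.∸-monoʳ-< 0<k (ℕ.<⇒≤ k<L))
    back : iter σ (L ∸ k) (iter σ k zero) ≡ zero
    back = begin
      iter σ (L ∸ k) (iter σ k zero) ≡⟨ iter-+ σ (L ∸ k) k zero ⟨
      iter σ (L ∸ k +ℕ k) zero        ≡⟨ cong (λ l → iter σ l zero) (ℕ.m∸n+n≡m (ℕ.<⇒≤ k<L)) ⟩
      iter σ L zero                  ≡⟨ returns (cycleLen-isCycleLength σ σ-perm zero) ⟩
      zero                           ∎
      where open ≡-Reasoning

module Conjugation {m n : ℕ} (σ : Vec (Fin n) n) (τ : Vec (Fin m) m) (τ-perm : IsPerm τ)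
  (m≤n : m ≤ n) (ι : Fin m → Fin n) (ι-injective : Injective _≡_ _≡_ ι)
  (ι-<ᵇ : ∀ a b → (toℕ (ι a) <ᵇ toℕ (ι b)) ≡ (toℕ a <ᵇ toℕ b))
  {k : Fin m} (conj : ∀ i → iter σ i (ι k) ≡ ι (iter τ i k)) where

  cycleLen-conj : cycleLen σ (ι k) ≡ cycleLen τ k
  cycleLen-conj = IsCycleLength⇒cycleLen≡ σ isL (ℕ.≤-trans (cycleLen≤n τ τ-perm k) m≤n)
    where
    isC = cycleLen-isCycleLength τ τ-perm k
    isL : IsCycleLength σ (ι k) (cycleLen τ k)
    isL = record
      { positive = positive isC
      ; returns  = trans (conj (cycleLen τ k)) (cong ι (returns isC))
      ; minimal  = λ {l} 0<l l<L ret → minimal isC 0<l l<L (ι-injective (trans (sym (conj l)) ret))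
      }

  isLeader-conj : isLeader σ (ι k) ≡ isLeader τ k
  isLeader-conj = begin
    all (λ i → toℕ (ι k) <ᵇ toℕ (iter σ i (ι k))) (map suc (upTo (cycleLen σ (ι k) ∸ 1)))
      ≡⟨ cong (λ L → all (λ i → toℕ (ι k) <ᵇ toℕ (iter σ i (ι k))) (map suc (upTo (L ∸ 1))))
              cycleLen-conj ⟩
    all (λ i → toℕ (ι k) <ᵇ toℕ (iter σ i (ι k))) (map suc (upTo (cycleLen τ k ∸ 1)))
      ≡⟨ all-cong below (map suc (upTo (cycleLen τ k ∸ 1))) ⟩
    all (λ i → toℕ k <ᵇ toℕ (iter τ i k)) (map suc (upTo (cycleLen τ k ∸ 1))) ∎
    where
    open ≡-Reasoning
    below : ∀ i → (toℕ (ι k) <ᵇ toℕ (iter σ i (ι k))) ≡ (toℕ k <ᵇ toℕ (iter τ i k))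
    below i = trans (cong (λ z → toℕ (ι k) <ᵇ toℕ z) (conj i)) (ι-<ᵇ k (iter τ i k))

  cycleLedBy-conj : cycleLedBy σ (ι k) ≡ cycleLedBy τ k
  cycleLedBy-conj = cong₂ (λ b L → if b then just L else nothing) isLeader-conj cycleLen-conj

-- Splicing a point into the cycle of 0

relabel : ∀ {n} → Fin (suc n) → Permutation′ n
relabel zero    = Perm.id
relabel {suc n} (suc a) = Perm.insert zero a Perm.id

⟨$⟩ʳ-injective : ∀ {n} (π : Permutation′ n) → Injective _≡_ _≡_ (π ⟨$⟩ʳ_)
⟨$⟩ʳ-injective π e = trans (sym (Perm.inverseˡ π)) (trans (cong (π ⟨$⟩ˡ_) e) (Perm.inverseˡ π))

⟨$⟩ˡ-injective : ∀ {n} (π : Permutation′ n) → Injective _≡_ _≡_ (π ⟨$⟩ˡ_)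
⟨$⟩ˡ-injective π e = trans (sym (Perm.inverseʳ π)) (trans (cong (π ⟨$⟩ʳ_) e) (Perm.inverseʳ π))

-- For a = 0 it adds the
-- fixed point 0 to τ; otherwise it is τ transported along punchIn a, with the new point a inserted
-- right after 0 in the cycle of 0.
splice : ∀ {n} → Fin (suc n) → Vec (Fin n) n → Vec (Fin (suc n)) (suc n)
splice a τ = a ∷ tabulate (λ j → punchIn a (lookup τ (relabel a ⟨$⟩ˡ j)))

module _ {n : ℕ} (a : Fin (suc n)) (τ : Vec (Fin n) n) where

  lookup-splice : ∀ j → lookup (splice a τ) (suc j) ≡ punchIn a (lookup τ (relabel a ⟨$⟩ˡ j))
  lookup-splice = Vec.lookup∘tabulate _

  lookup-splice-relabel : ∀ k → lookup (splice a τ) (suc (relabel a ⟨$⟩ʳ k)) ≡ punchIn a (lookup τ k)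
  lookup-splice-relabel k =
    trans (lookup-splice _) (cong (λ l → punchIn a (lookup τ l)) (Perm.inverseˡ (relabel a)))

  IsPerm-splice : IsPerm τ → IsPerm (splice a τ)
  IsPerm-splice τ-perm {zero}  {zero}  _ = refl
  IsPerm-splice τ-perm {zero}  {suc j} e =
    contradiction (trans e (lookup-splice j)) (Fin.punchInᵢ≢i a (lookup τ (relabel a ⟨$⟩ˡ j)) ∘ sym)
  IsPerm-splice τ-perm {suc i} {zero}  e =
    contradiction (trans (sym (lookup-splice i)) e) (Fin.punchInᵢ≢i a (lookup τ (relabel a ⟨$⟩ˡ i)))
  IsPerm-splice τ-perm {suc i} {suc j} e = cong suc (⟨$⟩ˡ-injective (relabel a)
    (τ-perm {relabel a ⟨$⟩ˡ i} {relabel a ⟨$⟩ˡ j}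
      (Fin.punchIn-injective a _ _ (trans (sym (lookup-splice i)) (trans e (lookup-splice j))))))

lookup-ext : ∀ {A : Set} {n} {u v : Vec A n} → (∀ i → lookup u i ≡ lookup v i) → u ≡ v
lookup-ext {u = u} {v} u≗v =
  trans (sym (Vec.tabulate∘lookup u)) (trans (Vec.tabulate-cong u≗v) (Vec.tabulate∘lookup v))

splice-injective : ∀ {n} {a b : Fin (suc n)} {τ τ′ : Vec (Fin n) n} →
                   splice a τ ≡ splice b τ′ → a ≡ b × τ ≡ τ′
splice-injective {a = a} {τ = τ} {τ′} e with refl ← Vec.∷-injectiveˡ e = refl , lookup-ext pointwise
  where
  pointwise : ∀ k → lookup τ k ≡ lookup τ′ k
  pointwise k = Fin.punchIn-injective a _ _ (begin
    punchIn a (lookup τ k)                          ≡⟨ lookup-splice-relabel a τ k ⟨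
    lookup (splice a τ) (suc (relabel a ⟨$⟩ʳ k))  ≡⟨ cong (λ σ → lookup σ (suc (relabel a ⟨$⟩ʳ k))) e ⟩
    lookup (splice a τ′) (suc (relabel a ⟨$⟩ʳ k)) ≡⟨ lookup-splice-relabel a τ′ k ⟩
    punchIn a (lookup τ′ k)                         ∎)
    where open ≡-Reasoning

splice-surjective : ∀ {n} (σ : Vec (Fin (suc n)) (suc n)) → IsPerm σ →
                    ∃[ a ] ∃[ τ ] IsPerm τ × splice a τ ≡ σ
splice-surjective {n} σ σ-perm = a , tabulate t , t-perm , lookup-ext spliced
  where
  a = lookup σ zero
  π = relabel a
  a≢ : ∀ k → a ≢ lookup σ (suc (π ⟨$⟩ʳ k))
  a≢ k e = Fin.0≢1+n (σ-perm {zero} {suc (π ⟨$⟩ʳ k)} e)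
  t : Fin n → Fin n
  t k = punchOut (a≢ k)
  t-perm : IsPerm (tabulate t)
  t-perm {k} {l} e = ⟨$⟩ʳ-injective π (Fin.suc-injective (σ-perm {suc (π ⟨$⟩ʳ k)} {suc (π ⟨$⟩ʳ l)}
    (Fin.punchOut-injective (a≢ k) (a≢ l)
      (trans (sym (Vec.lookup∘tabulate t k)) (trans e (Vec.lookup∘tabulate t l))))))
  spliced : ∀ i → lookup (splice a (tabulate t)) i ≡ lookup σ i
  spliced zero    = refl
  spliced (suc j) = begin
    lookup (splice a (tabulate t)) (suc j)        ≡⟨ lookup-splice a (tabulate t) j ⟩
    punchIn a (lookup (tabulate t) (π ⟨$⟩ˡ j))   ≡⟨ cong (punchIn a) (Vec.lookup∘tabulate t _) ⟩
    punchIn a (t (π ⟨$⟩ˡ j))                      ≡⟨ Fin.punchIn-punchOut (a≢ (π ⟨$⟩ˡ j)) ⟩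
    lookup σ (suc (π ⟨$⟩ʳ (π ⟨$⟩ˡ j)))            ≡⟨ cong (λ i → lookup σ (suc i)) (Perm.inverseʳ π) ⟩
    lookup σ (suc j)                              ∎
    where open ≡-Reasoning

punchIn-<ᵇ : ∀ {n} (i : Fin (suc n)) a b →
             (toℕ (punchIn i a) <ᵇ toℕ (punchIn i b)) ≡ (toℕ a <ᵇ toℕ b)
punchIn-<ᵇ zero    a       b       = refl
punchIn-<ᵇ (suc i) zero    zero    = refl
punchIn-<ᵇ (suc i) zero    (suc b) = refl
punchIn-<ᵇ (suc i) (suc a) zero    = refl
punchIn-<ᵇ (suc i) (suc a) (suc b) = punchIn-<ᵇ i a b

module SpliceZero {n} (τ : Vec (Fin n) n) (τ-perm : IsPerm τ) where

  σ = splice zero τ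

  iter-suc : ∀ i k → iter σ i (suc k) ≡ suc (iter τ i k)
  iter-suc zero    k = refl
  iter-suc (suc i) k = trans (cong (lookup σ) (iter-suc i k)) (lookup-splice zero τ _)

  cycleLedBy-suc : ∀ k → cycleLedBy σ (suc k) ≡ cycleLedBy τ k
  cycleLedBy-suc k =
    Conjugation.cycleLedBy-conj σ τ τ-perm (ℕ.n≤1+n n) suc Fin.suc-injective (λ _ _ → refl)
      (λ i → iter-suc i k)

module SpliceSuc {m} (a : Fin (suc m)) (τ : Vec (Fin (suc m)) (suc m)) (τ-perm : IsPerm τ) where

  σ = splice (suc a) τ
  ι = punchIn (suc a)
  L = cycleLen τ zero
  isτ = cycleLen-isCycleLength τ τ-perm zero

  σ-perm : IsPerm σ
  σ-perm = IsPerm-splice (suc a) τ τ-perm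

  lookup-ι : ∀ k → k ≢ zero → lookup σ (ι k) ≡ ι (lookup τ k)
  lookup-ι zero    k≢0 = contradiction refl k≢0
  lookup-ι (suc u) _   = lookup-splice-relabel (suc a) τ (suc u)

  orbit-zero : ∀ {i} → 0 < i → i ≤ L → iter σ (suc i) zero ≡ ι (iter τ i zero)
  orbit-zero {suc zero}    _ _   = lookup-splice-relabel (suc a) τ zero
  orbit-zero {suc (suc i)} _ i<L =
    trans (cong (lookup σ) (orbit-zero z<s (ℕ.<⇒≤ i<L))) (lookup-ι _ (minimal isτ z<s i<L))

  cycleLen-zero : cycleLen σ zero ≡ suc L
  cycleLen-zero = IsCycleLength⇒cycleLen≡ σ isσ (s≤s (cycleLen≤n τ τ-perm zero))
    where
    leaves : ∀ {k} → 0 < k → k < suc L → iter σ k zero ≢ zero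
    leaves {suc zero}    _ _         ()
    leaves {suc (suc i)} _ (s<s i<L) e =
      minimal isτ z<s i<L (Fin.punchIn-injective (suc a) _ zero (trans (sym (orbit-zero z<s (ℕ.<⇒≤ i<L))) e))
    isσ : IsCycleLength σ zero (suc L)
    isσ = record
      { positive = z<s
      ; returns  = trans (orbit-zero (positive isτ) ℕ.≤-refl) (cong ι (returns isτ))
      ; minimal  = leaves
      }

  cycleLedBy-inserted : cycleLedBy σ (suc a) ≡ nothing
  cycleLedBy-inserted = cycleLedBy-nonLeader σ {suc a}
    (isLeader-orbit-zero σ σ-perm {1} z<s (subst (1 <_) (sym cycleLen-zero) (s<s (positive isτ))))

  -- On the cycle of 0 both points are non-leaders, 0 leading it; off that cycle σ and τ are
  -- conjugate by ι.
  cycleLedBy-ι : ∀ k → k ≢ zero → cycleLedBy σ (ι k) ≡ cycleLedBy τ k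
  cycleLedBy-ι k k≢0 with ℕ.anyUpTo? (λ i → iter τ i zero ≟ k) L
  ... | yes (i , i<L , refl) = trans
    (cong (cycleLedBy σ) (sym (orbit-zero 0<i (ℕ.<⇒≤ i<L))))
    (trans (cycleLedBy-nonLeader σ {iter σ (suc i) zero}
             (isLeader-orbit-zero σ σ-perm z<s (subst (suc i <_) (sym cycleLen-zero) (s<s i<L))))
           (sym (cycleLedBy-nonLeader τ {iter τ i zero} (isLeader-orbit-zero τ τ-perm 0<i i<L))))
    where
    0<i : 0 < i
    0<i = ℕ.n≢0⇒n>0 λ { refl → k≢0 refl }
  ... | no k∉ = Conjugation.cycleLedBy-conj σ τ τ-perm (ℕ.n≤1+n _) ι (Fin.punchIn-injective (suc a) _ _)
                  (punchIn-<ᵇ (suc a)) conj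
    where
    conj : ∀ i → iter σ i (ι k) ≡ ι (iter τ i k)
    conj zero    = refl
    conj (suc i) = trans (cong (lookup σ) (conj i))
      (lookup-ι _ λ e → ¬OnOrbit-iter τ τ-perm isτ k∉ i (0 , positive isτ , sym e))

T-⇒ᵇ : ∀ a b → T (a ⇒ᵇ b) ⇔ (T a → T b)
T-⇒ᵇ false b = mk⇔ (λ _ ()) (λ _ → _)
T-⇒ᵇ true  b = mk⇔ (λ t _ → t) (λ f → f _)

T-all-allFin : ∀ {n} (b : Fin n → Bool) → T (all b (allFin n)) ⇔ (∀ i → T (b i))
T-all-allFin {n} b = mk⇔ (All.tabulate⁻ ∘ All.all⁺ b (allFin n)) (All.all⁻ b ∘ All.tabulate⁺)

isInjective⇔IsPerm : ∀ {n} (v : Vec (Fin n) n) → T (isInjective v) ⇔ IsPerm v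
isInjective⇔IsPerm {n} v = mk⇔ to from
  where
  entry : Fin n → Fin n → Bool
  entry i j = ⌊ lookup v i ≟ lookup v j ⌋ ⇒ᵇ ⌊ i ≟ j ⌋
  entries : T (isInjective v) ⇔ (∀ i j → T (entry i j))
  entries = mk⇔ (λ t i → Equivalence.to (T-all-allFin (entry i)) (Equivalence.to (T-all-allFin _) t i))
                (λ t → Equivalence.from (T-all-allFin _) λ i → Equivalence.from (T-all-allFin (entry i)) (t i))
  to : T (isInjective v) → IsPerm v
  to t {i} {j} e = toWitness {a? = i ≟ j}
    (Equivalence.to (T-⇒ᵇ _ _) (Equivalence.to entries t i j) (fromWitness {a? = lookup v i ≟ lookup v j} e))
  from : IsPerm v → T (isInjective v)
  from v-perm = Equivalence.from entries λ i j → Equivalence.from (T-⇒ᵇ _ _)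
    (fromWitness {a? = i ≟ j} ∘ v-perm ∘ toWitness {a? = lookup v i ≟ lookup v j})

concatMap≡cartesianProductWith : ∀ {A B C : Set} (f : A → B → C) xs ys →
  concatMap (λ x → map (f x) ys) xs ≡ cartesianProductWith f xs ys
concatMap≡cartesianProductWith f []       ys = refl
concatMap≡cartesianProductWith f (x ∷ xs) ys = cong (map (f x) ys ++_) (concatMap≡cartesianProductWith f xs ys)

vecsOver-suc : ∀ {A : Set} (xs : List A) m →
  vecsOver xs (suc m) ≡ cartesianProductWith (λ v a → a ∷ v) (vecsOver xs m) xs
vecsOver-suc xs m = concatMap≡cartesianProductWith (λ v a → a ∷ v) (vecsOver xs m) xs

∈-vecsOver : ∀ {n m} (v : Vec (Fin n) m) → v ∈ vecsOver (allFin n) m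
∈-vecsOver []                  = here refl
∈-vecsOver {n} {suc m} (a ∷ v) rewrite vecsOver-suc (allFin n) m =
  ∈.∈-cartesianProductWith⁺ (λ v a → a ∷ v) (∈-vecsOver v) (∈.∈-allFin a)

vecsOver-unique : ∀ n m → Unique (vecsOver (allFin n) m)
vecsOver-unique n zero    = All.[] AllPairs.∷ AllPairs.[]
vecsOver-unique n (suc m) rewrite vecsOver-suc (allFin n) m =
  Unique.cartesianProductWith⁺ (λ v a → a ∷ v) (λ e → Vec.∷-injectiveʳ e , Vec.∷-injectiveˡ e)
    (vecsOver-unique n m) (Unique.allFin⁺ n)

∈-Perms⁻ : ∀ {n} {σ : Vec (Fin n) n} → σ ∈ Perms n → IsPerm σ
∈-Perms⁻ {n} {σ} σ∈ =
  Equivalence.to (isInjective⇔IsPerm σ)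
    (proj₂ (∈.∈-filter⁻ (T? ∘ isInjective) {xs = vecsOver (allFin n) n} σ∈))

∈-Perms⁺ : ∀ {n} {σ : Vec (Fin n) n} → IsPerm σ → σ ∈ Perms n
∈-Perms⁺ {σ = σ} σ-perm =
  ∈.∈-filter⁺ (T? ∘ isInjective) (∈-vecsOver σ) (Equivalence.from (isInjective⇔IsPerm σ) σ-perm)

Perms-unique : ∀ n → Unique (Perms n)
Perms-unique n = Unique.filter⁺ (T? ∘ isInjective) (vecsOver-unique n n)

splices↭Perms : ∀ n → cartesianProductWith splice (allFin (suc n)) (Perms n) ↭ Perms (suc n)
splices↭Perms n = ∼bag⇒↭ (unique∧set⇒bag
  (Unique.cartesianProductWith⁺ splice splice-injective (Unique.allFin⁺ (suc n)) (Perms-unique n))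
  (Perms-unique (suc n))
  (mk⇔ spliced∈ ∈spliced))
  where
  spliced∈ : ∀ {σ} → σ ∈ cartesianProductWith splice (allFin (suc n)) (Perms n) → σ ∈ Perms (suc n)
  spliced∈ σ∈
    with a , τ , _ , τ∈ , refl ← ∈.∈-cartesianProductWith⁻ splice (allFin (suc n)) (Perms n) σ∈
    = ∈-Perms⁺ {σ = splice a τ} (IsPerm-splice a τ (∈-Perms⁻ τ∈))
  ∈spliced : ∀ {σ} → σ ∈ Perms (suc n) → σ ∈ cartesianProductWith splice (allFin (suc n)) (Perms n)
  ∈spliced {σ} σ∈ with a , τ , τ-perm , refl ← splice-surjective σ (∈-Perms⁻ σ∈)
    = ∈.∈-cartesianProductWith⁺ splice (∈.∈-allFin a) (∈-Perms⁺ {σ = τ} τ-perm)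

falling-suc : ∀ n k → falling (suc n) (suc k) ≡ suc n *ℕ falling n k
falling-suc n zero    = refl
falling-suc n (suc k) = trans (cong ((n ∸ k) *ℕ_) (falling-suc n k))
  (CommutativeSemigroup.x∙yz≈y∙xz ℕ.*-commutativeSemigroup (n ∸ k) (suc n) (falling n k))

-- Weighted sums

module Sums {c ℓ} (R : CommutativeSemiring c ℓ) where

  open CommutativeSemiring R hiding (zero)
    renaming (refl to ≈-refl; sym to ≈-sym; trans to ≈-trans; reflexive to ≈-reflexive)
  open import Algebra.Properties.Semiring.Mult semiring using (×1-homo-*) renaming (_×_ to _×ᴿ_)
  open import Relation.Binary.Reasoning.Setoid setoid

  fromℕ≡×1# : ∀ n → fromℕ R n ≡ n ×ᴿ 1#
  fromℕ≡×1# zero    = refl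
  fromℕ≡×1# (suc n) = cong (1# +_) (fromℕ≡×1# n)

  fromℕ-* : ∀ m n → fromℕ R (m *ℕ n) ≈ fromℕ R m * fromℕ R n
  fromℕ-* m n = begin
    fromℕ R (m *ℕ n)          ≡⟨ fromℕ≡×1# (m *ℕ n) ⟩
    (m *ℕ n) ×ᴿ 1#            ≈⟨ ×1-homo-* m n ⟩
    (m ×ᴿ 1#) * (n ×ᴿ 1#)     ≡⟨ cong₂ _*_ (fromℕ≡×1# m) (fromℕ≡×1# n) ⟨
    fromℕ R m * fromℕ R n     ∎

  sumR-map-cong : ∀ {A : Set} (xs : List A) {f g : A → Carrier} → (∀ {a} → a ∈ xs → f a ≈ g a) →
                  sumR R (map f xs) ≈ sumR R (map g xs)
  sumR-map-cong []       _   = ≈-refl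
  sumR-map-cong (a ∷ xs) f≈g = +-cong (f≈g (here refl)) (sumR-map-cong xs (f≈g ∘ there))

  sumR-map-↭ : ∀ {A : Set} (f : A → Carrier) {xs ys : List A} → xs ↭ ys →
               sumR R (map f xs) ≈ sumR R (map f ys)
  sumR-map-↭ f xs↭ys =
    ↭ₛ.foldr-commMonoid setoid +-isCommutativeMonoid (↭.↭⇒↭ₛ′ isEquivalence (↭.map⁺ f xs↭ys))

  sumR-++ : ∀ xs ys → sumR R (xs ++ ys) ≈ sumR R xs + sumR R ys
  sumR-++ []       ys = ≈-sym (+-identityˡ _)
  sumR-++ (x ∷ xs) ys = ≈-trans (+-congˡ (sumR-++ xs ys)) (≈-sym (+-assoc _ _ _))

  sumR-cartesianProductWith : ∀ {A B C : Set} (f : A → B → C) (F : C → Carrier) xs ys →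
    sumR R (map F (cartesianProductWith f xs ys)) ≈ sumR R (map (λ a → sumR R (map (F ∘ f a) ys)) xs)
  sumR-cartesianProductWith f F []       ys = ≈-refl
  sumR-cartesianProductWith f F (a ∷ xs) ys = begin
    sumR R (map F (map (f a) ys ++ cartesianProductWith f xs ys))
      ≡⟨ cong (sumR R) (List.map-++ F (map (f a) ys) _) ⟩
    sumR R (map F (map (f a) ys) ++ map F (cartesianProductWith f xs ys))
      ≈⟨ sumR-++ (map F (map (f a) ys)) _ ⟩
    sumR R (map F (map (f a) ys)) + sumR R (map F (cartesianProductWith f xs ys))
      ≈⟨ +-cong (≈-reflexive (cong (sumR R) (sym (List.map-∘ ys)))) (sumR-cartesianProductWith f F xs ys) ⟩
    sumR R (map (F ∘ f a) ys) + sumR R (map (λ a → sumR R (map (F ∘ f a) ys)) xs) ∎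

  sumR-map-*ˡ : ∀ {A : Set} c (f : A → Carrier) xs →
                sumR R (map (λ a → c * f a) xs) ≈ c * sumR R (map f xs)
  sumR-map-*ˡ c f []       = ≈-sym (zeroʳ c)
  sumR-map-*ˡ c f (a ∷ xs) = ≈-trans (+-congˡ (sumR-map-*ˡ c f xs)) (≈-sym (distribˡ c _ _))

  sumR-tabulate-const : ∀ {n} (h : Fin n → Carrier) {v} → (∀ i → h i ≈ v) →
                        sumR R (List.tabulate h) ≈ fromℕ R n * v
  sumR-tabulate-const {zero}  h {v} _   = ≈-sym (zeroˡ v)
  sumR-tabulate-const {suc n} h {v} h≈v = begin
    h zero + sumR R (List.tabulate (h ∘ suc))
      ≈⟨ +-cong (h≈v zero) (sumR-tabulate-const (h ∘ suc) (h≈v ∘ suc)) ⟩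
    v + fromℕ R n * v                         ≈⟨ +-congʳ (*-identityˡ v) ⟨
    1# * v + fromℕ R n * v                    ≈⟨ distribʳ v 1# (fromℕ R n) ⟨
    (1# + fromℕ R n) * v                      ∎

  sumR-applyUpTo-cong : ∀ n {f g : ℕ → Carrier} → (∀ {k} → k < n → f k ≈ g k) →
                        sumR R (applyUpTo f n) ≈ sumR R (applyUpTo g n)
  sumR-applyUpTo-cong zero    _   = ≈-refl
  sumR-applyUpTo-cong (suc n) f≈g = +-cong (f≈g z<s) (sumR-applyUpTo-cong n (f≈g ∘ s<s))

  sumR-applyUpTo-*ˡ : ∀ n c (f : ℕ → Carrier) →
                      sumR R (applyUpTo (λ k → c * f k) n) ≈ c * sumR R (applyUpTo f n)
  sumR-applyUpTo-*ˡ zero    c f = ≈-sym (zeroʳ c)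
  sumR-applyUpTo-*ˡ (suc n) c f =
    ≈-trans (+-congˡ (sumR-applyUpTo-*ˡ n c (f ∘ suc))) (≈-sym (distribˡ c _ _))

  sumR-Perms-suc : ∀ n (F : Vec (Fin (suc n)) (suc n) → Carrier) →
    sumR R (map F (Perms (suc n))) ≈ sumR R (List.tabulate (λ a → sumR R (map (F ∘ splice a) (Perms n))))
  sumR-Perms-suc n F = begin
    sumR R (map F (Perms (suc n)))
      ≈⟨ sumR-map-↭ F (splices↭Perms n) ⟨
    sumR R (map F (cartesianProductWith splice (allFin (suc n)) (Perms n)))
      ≈⟨ sumR-cartesianProductWith splice F (allFin (suc n)) (Perms n) ⟩
    sumR R (map (λ a → sumR R (map (F ∘ splice a) (Perms n))) (allFin (suc n)))
      ≡⟨ cong (sumR R) (List.map-tabulate id (λ a → sumR R (map (F ∘ splice a) (Perms n)))) ⟩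
    sumR R (List.tabulate (λ a → sumR R (map (F ∘ splice a) (Perms n)))) ∎

module CycleWeights {c ℓ} (R : CommutativeSemiring c ℓ) (r : ℕ) (x y : CommutativeSemiring.Carrier R) where

  open CommutativeSemiring R hiding (zero)
    renaming (refl to ≈-refl; sym to ≈-sym; trans to ≈-trans; reflexive to ≈-reflexive)
  open Sums R
  open CommutativeSemigroup *-commutativeSemigroup using (x∙yz≈y∙xz)
  open import Algebra.Properties.CommutativeMonoid.Sum *-commutativeMonoid
    using () renaming (sum to ∏; sum-cong-≋ to ∏-cong; sum-cong-≗ to ∏-cong-≗; sum-remove to ∏-remove)
  open import Relation.Binary.Reasoning.Setoid setoid

  Wʳ : ℕ → Carrier
  Wʳ n = W R r n x y

  cycleWeight : ℕ → Carrier
  cycleWeight L = if ⌊ r ∣? L ⌋ then y else x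

  cycleWeight-regular : ∀ {k} → 0 < k → k < r → cycleWeight k ≡ x
  cycleWeight-regular {suc k} _ k<r with r ∣? suc k
  ... | yes r∣k = contradiction (∣⇒≤ r∣k) (ℕ.<⇒≱ k<r)
  ... | no  _   = refl

  cycleWeight-singular : cycleWeight r ≡ y
  cycleWeight-singular with r ∣? r
  ... | yes _  = refl
  ... | no r∤r = contradiction ∣-refl r∤r

  cycleWeight-periodic : ∀ k → cycleWeight (r +ℕ k) ≡ cycleWeight k
  cycleWeight-periodic k with r ∣? (r +ℕ k) | r ∣? k
  ... | yes _     | yes _   = refl
  ... | no  _     | no  _   = refl
  ... | yes r∣r+k | no  r∤k = contradiction (∣m+n∣m⇒∣n r∣r+k ∣-refl) r∤k
  ... | no  r∤r+k | yes r∣k = contradiction (∣m∣n⇒∣m+n ∣-refl r∣k) r∤r+k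

  pointWeight : ∀ {n} → Vec (Fin n) n → Fin n → Carrier
  pointWeight σ i = maybe′ cycleWeight 1# (cycleLedBy σ i)

  weight : ∀ {n} → Vec (Fin n) n → Carrier
  weight σ = pow R x (regCycles r σ) * pow R y (singCycles r σ)

  tally : ∀ {n} → (Fin n → Bool) → ℕ
  tally p = List.foldr _+ℕ_ 0 (List.tabulate (λ i → if p i then 1 else 0))

  pow-tally : ∀ {n} (b d : Fin n → Bool) →
    pow R x (tally (λ i → b i ∧ not (d i))) * pow R y (tally (λ i → b i ∧ d i))
      ≈ ∏ (λ i → if b i then (if d i then y else x) else 1#)
  pow-tally {zero}  b d = *-identityˡ 1#
  pow-tally {suc n} b d with b zero | d zero | pow-tally (b ∘ suc) (d ∘ suc)
  ... | true  | true  | tail = ≈-trans (x∙yz≈y∙xz _ y _) (*-congˡ tail)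
  ... | true  | false | tail = ≈-trans (*-assoc x _ _) (*-congˡ tail)
  ... | false | _     | tail = ≈-trans tail (≈-sym (*-identityˡ _))

  pointWeight-isLeader : ∀ {n} (σ : Vec (Fin n) n) i →
    pointWeight σ i ≡ (if isLeader σ i then cycleWeight (cycleLen σ i) else 1#)
  pointWeight-isLeader σ i with isLeader σ i
  ... | true  = refl
  ... | false = refl

  weight≈∏pointWeight : ∀ {n} (σ : Vec (Fin n) n) → weight σ ≈ ∏ (pointWeight σ)
  weight≈∏pointWeight {n} σ = begin
    weight σ
      ≡⟨ cong₂ (λ a b → pow R x a * pow R y b) (tallied regular) (tallied singular) ⟩
    pow R x (tally regular) * pow R y (tally singular)
      ≈⟨ pow-tally (isLeader σ) divides ⟩
    ∏ (λ i → if isLeader σ i then cycleWeight (cycleLen σ i) else 1#)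
      ≡⟨ ∏-cong-≗ (λ i → sym (pointWeight-isLeader σ i)) ⟩
    ∏ (pointWeight σ) ∎
    where
    divides regular singular : Fin n → Bool
    divides i  = ⌊ r ∣? cycleLen σ i ⌋
    regular i  = isLeader σ i ∧ not (divides i)
    singular i = isLeader σ i ∧ divides i
    tallied : ∀ p → List.foldr _+ℕ_ 0 (map (λ i → if p i then 1 else 0) (allFin n)) ≡ tally p
    tallied p = cong (List.foldr _+ℕ_ 0) (List.map-tabulate id (λ i → if p i then 1 else 0))

  rootedWeight : ∀ {m} → (ℕ → Carrier) → Vec (Fin (suc m)) (suc m) → Carrier
  rootedWeight g σ = g (cycleLen σ zero) * ∏ (λ j → pointWeight σ (suc j))

  rootedW : ℕ → (ℕ → Carrier) → Carrier
  rootedW m g = sumR R (map (rootedWeight g) (Perms (suc m)))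

  W-suc≈rootedW : ∀ m → Wʳ (suc m) ≈ rootedW m cycleWeight
  W-suc≈rootedW m = sumR-map-cong (Perms (suc m)) λ {σ} σ∈ → ≈-trans (weight≈∏pointWeight σ)
    (*-congʳ (≈-reflexive (trans (pointWeight-isLeader σ zero)
      (cong (λ b → if b then cycleWeight (cycleLen σ zero) else 1#) (isLeader-zero σ (∈-Perms⁻ σ∈))))))

  rootedWeight-splice-zero : ∀ {n} g (τ : Vec (Fin n) n) → IsPerm τ →
                             rootedWeight g (splice zero τ) ≈ g 1 * weight τ
  rootedWeight-splice-zero g τ τ-perm = *-congˡ (≈-trans
    (∏-cong (λ j → ≈-reflexive (cong (maybe′ cycleWeight 1#) (SpliceZero.cycleLedBy-suc τ τ-perm j))))
    (≈-sym (weight≈∏pointWeight τ)))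

  rootedWeight-splice-suc : ∀ {m} g a (τ : Vec (Fin (suc m)) (suc m)) → IsPerm τ →
                            rootedWeight g (splice (suc a) τ) ≈ rootedWeight (g ∘ suc) τ
  rootedWeight-splice-suc g a τ τ-perm = begin
    g (cycleLen σ zero) * ∏ (λ j → pointWeight σ (suc j))
      ≈⟨ *-cong (≈-reflexive (cong g cycleLen-zero)) (∏-remove {i = a} (λ j → pointWeight σ (suc j))) ⟩
    g (suc L) * (pointWeight σ (suc a) * ∏ (λ u → pointWeight σ (suc (punchIn a u))))
      ≈⟨ *-congˡ (*-cong (≈-reflexive (cong (maybe′ cycleWeight 1#) cycleLedBy-inserted))
                         (∏-cong λ u →
                            ≈-reflexive (cong (maybe′ cycleWeight 1#) (cycleLedBy-ι (suc u) λ ())))) ⟩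
    g (suc L) * (1# * ∏ (λ u → pointWeight τ (suc u)))
      ≈⟨ *-congˡ (*-identityˡ _) ⟩
    g (suc L) * ∏ (λ u → pointWeight τ (suc u)) ∎
    where open SpliceSuc a τ τ-perm

  rootedW-splice : ∀ m g → rootedW m g ≈
    g 1 * Wʳ m + sumR R (List.tabulate (λ a → sumR R (map (rootedWeight g ∘ splice (suc a)) (Perms m))))
  rootedW-splice m g = ≈-trans (sumR-Perms-suc m (rootedWeight g)) (+-congʳ (begin
    sumR R (map (rootedWeight g ∘ splice zero) (Perms m))
      ≈⟨ sumR-map-cong (Perms m) (λ {τ} τ∈ → rootedWeight-splice-zero g τ (∈-Perms⁻ τ∈)) ⟩
    sumR R (map (λ τ → g 1 * weight τ) (Perms m))
      ≈⟨ sumR-map-*ˡ (g 1) weight (Perms m) ⟩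
    g 1 * Wʳ m ∎))

  rootedW-zero : ∀ g → rootedW 0 g ≈ g 1 * Wʳ 0
  rootedW-zero g = ≈-trans (rootedW-splice 0 g) (+-identityʳ _)

  rootedW-suc : ∀ m g → rootedW (suc m) g ≈ g 1 * Wʳ (suc m) + fromℕ R (suc m) * rootedW m (g ∘ suc)
  rootedW-suc m g = ≈-trans (rootedW-splice (suc m) g) (+-congˡ (sumR-tabulate-const _ λ a →
    sumR-map-cong (Perms (suc m)) λ {τ} τ∈ → rootedWeight-splice-suc g a τ (∈-Perms⁻ τ∈)))

  rootedW-cong : ∀ m {g h} → (∀ {k} → 0 < k → k ≤ suc m → g k ≈ h k) → rootedW m g ≈ rootedW m h
  rootedW-cong zero    {g} {h} g≈h = begin
    rootedW 0 g ≈⟨ rootedW-zero g ⟩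
    g 1 * Wʳ 0  ≈⟨ *-congʳ (g≈h z<s ℕ.≤-refl) ⟩
    h 1 * Wʳ 0  ≈⟨ rootedW-zero h ⟨
    rootedW 0 h ∎
  rootedW-cong (suc m) {g} {h} g≈h = begin
    rootedW (suc m) g
      ≈⟨ rootedW-suc m g ⟩
    g 1 * Wʳ (suc m) + fromℕ R (suc m) * rootedW m (g ∘ suc)
      ≈⟨ +-cong (*-congʳ (g≈h z<s (s≤s z≤n)))
                (*-congˡ (rootedW-cong m λ _ k≤ → g≈h z<s (s≤s k≤))) ⟩
    h 1 * Wʳ (suc m) + fromℕ R (suc m) * rootedW m (h ∘ suc)
      ≈⟨ rootedW-suc m h ⟨
    rootedW (suc m) h ∎

  rootedW-pred : ∀ m {g} → (∀ {k} → 0 < k → k ≤ m → g (suc k) ≈ cycleWeight k) →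
                 rootedW m g ≈ (g 1 + fromℕ R m) * Wʳ m
  rootedW-pred zero    {g} _   = ≈-trans (rootedW-zero g) (*-congʳ (≈-sym (+-identityʳ _)))
  rootedW-pred (suc m) {g} g≈w = begin
    rootedW (suc m) g
      ≈⟨ rootedW-suc m g ⟩
    g 1 * Wʳ (suc m) + fromℕ R (suc m) * rootedW m (g ∘ suc)
      ≈⟨ +-congˡ (*-congˡ (rootedW-cong m g≈w)) ⟩
    g 1 * Wʳ (suc m) + fromℕ R (suc m) * rootedW m cycleWeight
      ≈⟨ +-congˡ (*-congˡ (W-suc≈rootedW m)) ⟨
    g 1 * Wʳ (suc m) + fromℕ R (suc m) * Wʳ (suc m)
      ≈⟨ distribʳ _ _ _ ⟨
    (g 1 + fromℕ R (suc m)) * Wʳ (suc m) ∎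

  fromℕ-falling-suc : ∀ n k →
                      fromℕ R (falling (suc n) (suc k)) ≈ fromℕ R (suc n) * fromℕ R (falling n k)
  fromℕ-falling-suc n k =
    ≈-trans (≈-reflexive (cong (fromℕ R) (falling-suc n k))) (fromℕ-* (suc n) (falling n k))

  rootedW-split : ∀ a b g → rootedW (a +ℕ b) g ≈
    sumR R (applyUpTo (λ k → fromℕ R (falling (a +ℕ b) k) * (g (suc k) * Wʳ (a +ℕ b ∸ k))) a)
    + fromℕ R (falling (a +ℕ b) a) * rootedW b (λ k → g (a +ℕ k))
  rootedW-split zero b g =
    ≈-sym (≈-trans (+-identityˡ _) (≈-trans (*-congʳ (+-identityʳ 1#)) (*-identityˡ _)))
  rootedW-split (suc a) b g = begin
    rootedW (suc n) g
      ≈⟨ rootedW-suc n g ⟩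
    g 1 * Wʳ (suc n) + N * rootedW n (g ∘ suc)
      ≈⟨ +-congˡ (*-congˡ (rootedW-split a b (g ∘ suc))) ⟩
    g 1 * Wʳ (suc n) + N * (sumR R (applyUpTo term a) + F * rest)
      ≈⟨ +-congˡ (distribˡ N _ _) ⟩
    g 1 * Wʳ (suc n) + (N * sumR R (applyUpTo term a) + N * (F * rest))
      ≈⟨ +-assoc _ _ _ ⟨
    (g 1 * Wʳ (suc n) + N * sumR R (applyUpTo term a)) + N * (F * rest)
      ≈⟨ +-cong (+-cong first others) coefficient ⟩
    sumR R (applyUpTo term′ (suc a)) + fromℕ R (falling (suc n) (suc a)) * rest ∎
    where
    n = a +ℕ b
    N = fromℕ R (suc n)
    F = fromℕ R (falling n a)
    rest = rootedW b (λ k → g (suc (a +ℕ k)))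
    term term′ : ℕ → Carrier
    term  k = fromℕ R (falling n k) * (g (suc (suc k)) * Wʳ (n ∸ k))
    term′ k = fromℕ R (falling (suc n) k) * (g (suc k) * Wʳ (suc n ∸ k))
    first : g 1 * Wʳ (suc n) ≈ term′ 0
    first = ≈-sym (≈-trans (*-congʳ (+-identityʳ 1#)) (*-identityˡ _))
    others : N * sumR R (applyUpTo term a) ≈ sumR R (applyUpTo (term′ ∘ suc) a)
    others = ≈-sym (≈-trans
      (sumR-applyUpTo-cong a λ {k} _ → ≈-trans (*-congʳ (fromℕ-falling-suc n k)) (*-assoc _ _ _))
      (sumR-applyUpTo-*ˡ a N term))
    coefficient : N * (F * rest) ≈ fromℕ R (falling (suc n) (suc a)) * rest
    coefficient = ≈-sym (≈-trans (*-congʳ (fromℕ-falling-suc n a)) (*-assoc _ _ _))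

  W-zero : Wʳ 0 ≈ 1#
  W-zero = ≈-trans (+-identityʳ _) (*-identityˡ 1#)

  W-rising : ∀ n → n < r → Wʳ n ≈ rising R x n
  W-rising zero    _     = W-zero
  W-rising (suc m) 1+m<r = begin
    Wʳ (suc m)                 ≈⟨ W-suc≈rootedW m ⟩
    rootedW m cycleWeight      ≈⟨ rootedW-pred m {cycleWeight} regular ⟩
    (cycleWeight 1 + fromℕ R m) * Wʳ m
      ≡⟨ cong (λ w → (w + fromℕ R m) * Wʳ m)
              (cycleWeight-regular z<s (ℕ.≤-<-trans (s≤s z≤n) 1+m<r)) ⟩
    (x + fromℕ R m) * Wʳ m     ≈⟨ *-comm _ _ ⟩
    Wʳ m * (x + fromℕ R m)     ≈⟨ *-congʳ (W-rising m (ℕ.<-trans (ℕ.n<1+n m) 1+m<r)) ⟩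
    rising R x m * (x + fromℕ R m) ∎
    where
    regular : ∀ {k} → 0 < k → k ≤ m → cycleWeight (suc k) ≈ cycleWeight k
    regular 0<k k≤m = ≈-reflexive (trans
      (cycleWeight-regular z<s (ℕ.≤-trans (s≤s (s≤s k≤m)) 1+m<r))
      (sym (cycleWeight-regular 0<k (ℕ.≤-trans (s≤s k≤m) (ℕ.<⇒≤ 1+m<r)))))

module _ {c ℓ} (R : CommutativeSemiring c ℓ) (r′ : ℕ) (x y : CommutativeSemiring.Carrier R) where

  open CommutativeSemiring R hiding (zero)
    renaming (refl to ≈-refl; sym to ≈-sym; trans to ≈-trans; reflexive to ≈-reflexive)
  open Sums R
  open CycleWeights R (suc r′) x y
  open CommutativeSemigroup *-commutativeSemigroup using (x∙yz≈y∙xz; xy∙z≈y∙xz)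
  open import Relation.Binary.Reasoning.Setoid setoid

  W-recurrence-+ : ∀ d → Wʳ (suc (r′ +ℕ d)) ≈
    x * sumR R (applyUpTo (λ k → fromℕ R (falling (r′ +ℕ d) k) * Wʳ (r′ +ℕ d ∸ k)) r′)
    + ((y + fromℕ R d) * fromℕ R (falling (r′ +ℕ d) r′)) * Wʳ d
  W-recurrence-+ d = begin
    Wʳ (suc n)
      ≈⟨ W-suc≈rootedW n ⟩
    rootedW n cycleWeight
      ≈⟨ rootedW-split r′ d cycleWeight ⟩
    sumR R (applyUpTo (λ k → fromℕ R (falling n k) * (cycleWeight (suc k) * Wʳ (n ∸ k))) r′)
      + F * rootedW d (λ k → cycleWeight (r′ +ℕ k))
      ≈⟨ +-cong regular (*-congˡ (rootedW-pred d {λ k → cycleWeight (r′ +ℕ k)} singular)) ⟩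
    S + F * ((cycleWeight (r′ +ℕ 1) + fromℕ R d) * Wʳ d)
      ≡⟨ cong (λ w → S + F * ((w + fromℕ R d) * Wʳ d)) root ⟩
    S + F * ((y + fromℕ R d) * Wʳ d)
      ≈⟨ +-congˡ (xy∙z≈y∙xz (y + fromℕ R d) F (Wʳ d)) ⟨
    S + ((y + fromℕ R d) * F) * Wʳ d ∎
    where
    n = r′ +ℕ d
    F = fromℕ R (falling n r′)
    S = x * sumR R (applyUpTo (λ k → fromℕ R (falling n k) * Wʳ (n ∸ k)) r′)
    regular : sumR R (applyUpTo (λ k → fromℕ R (falling n k) * (cycleWeight (suc k) * Wʳ (n ∸ k))) r′) ≈ S
    regular = ≈-trans
      (sumR-applyUpTo-cong r′ λ k<r′ →
        ≈-trans (*-congˡ (*-congʳ (≈-reflexive (cycleWeight-regular z<s (s≤s k<r′)))))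
                (x∙yz≈y∙xz _ x _))
      (sumR-applyUpTo-*ˡ r′ x (λ k → fromℕ R (falling n k) * Wʳ (n ∸ k)))
    singular : ∀ {k} → 0 < k → k ≤ d → cycleWeight (r′ +ℕ suc k) ≈ cycleWeight k
    singular {k} _ _ = ≈-reflexive (trans (cong cycleWeight (ℕ.+-suc r′ k)) (cycleWeight-periodic k))
    root : cycleWeight (r′ +ℕ 1) ≡ y
    root = trans (cong cycleWeight (ℕ.+-comm r′ 1)) cycleWeight-singular

  W-recurrence : ∀ n → suc r′ ≤ n → Wʳ n ≈
    x * sumR R (map (λ i → fromℕ R (falling (n ∸ 1) (i ∸ 1)) * Wʳ (n ∸ i)) (map suc (upTo r′)))
    + ((y + fromℕ R (n ∸ suc r′)) * fromℕ R (falling (n ∸ 1) r′)) * Wʳ (n ∸ suc r′)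
  W-recurrence n r≤n with d , refl ← ℕ.m≤n⇒∃[o]m+o≡n r≤n =
    ≈-trans (W-recurrence-+ d) (≈-reflexive (cong₂
      (λ s e → x * s + ((y + fromℕ R e) * fromℕ R (falling (r′ +ℕ d) r′)) * Wʳ e)
      (cong (sumR R) (sym (trans (cong (map term) (List.map-upTo suc r′)) (List.map-applyUpTo suc term r′))))
      (sym (ℕ.m+n∸m≡n r′ d))))
    where
    term : ℕ → Carrier
    term i = fromℕ R (falling (r′ +ℕ d) (i ∸ 1)) * Wʳ (suc (r′ +ℕ d) ∸ i)

theorem3p1 : {c ℓ : Level} (R : CommutativeSemiring c ℓ) (r : ℕ) → 2 ≤ r →
    (x y : CommutativeSemiring.Carrier R) →
    ((n : ℕ) → n < r →
       CommutativeSemiring._≈_ R (W R r n x y) (rising R x n))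
    ×
    ((n : ℕ) → r ≤ n →
       CommutativeSemiring._≈_ R (W R r n x y)
         (CommutativeSemiring._+_ R
           (CommutativeSemiring._*_ R x
             (sumR R (map (λ i → CommutativeSemiring._*_ R (fromℕ R (falling (n ∸ 1) (i ∸ 1))) (W R r (n ∸ i) x y))
                          (map suc (upTo (r ∸ 1))))))
           (CommutativeSemiring._*_ R
             (CommutativeSemiring._*_ R (CommutativeSemiring._+_ R y (fromℕ R (n ∸ r))) (fromℕ R (falling (n ∸ 1) (r ∸ 1))))
             (W R r (n ∸ r) x y))))
-- The hypothesis 2 ≤ r is only needed as r ≢ 0.
theorem3p1 R (suc r′) _ x y = CycleWeights.W-rising R (suc r′) x y , W-recurrence R r′ x y
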